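{- For every integer $t\ge2$, \[m_4(\mathbb{Z}_{11t})\le\frac{10+m_4(\mathbb{Z}_t)}{121}.\]
   Context: A $k$-AP in $\mathbb{Z}_n$ is an ordered sequence $(a,a+d,\dots,a+(k-1)d)$ with $(a,d)\in\mathbb{Z}_n^2$; degenerate progressions are allowed and there are exactly $n^2$ of them. For $c:\mathbb{Z}_n\to\{0,1\}$, $m_k(\mathbb{Z}_n,c)$ is the number of pairs $(a,d)$ whose $k$-AP is monochromatic, and $m_k(\mathbb{Z}_n)=\min_c m_k(\mathbb{Z}_n,c)/n^2$. -}

module Defs where

open import Data.Nat using (ℕ; zero; suc; _+_; _*_; _⊓_; NonZero)
open import Data.Nat.DivMod using (_%_)
open import Data.Nat.Properties using (m*n≢0)
open import Data.Bool using (Bool; true; false; _∧_; if_then_else_)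
open import Data.Fin using (Fin; toℕ; fromℕ<)
open import Data.Fin.Properties using (all?)
open import Data.Nat.DivMod using (m%n<n)
open import Data.List using (List; []; _∷_; map; allFin; foldr; concatMap)
open import Data.Nat.ListAction using (sum)
open import Data.Integer using (+_)
open import Data.Rational.Unnormalised using (ℚᵘ; _/_)
open import Relation.Binary.PropositionalEquality using (_≡_)
open import Relation.Nullary.Decidable using (⌊_⌋)
open import Data.Bool.Properties using (_≟_)

-- ℤ_n is modelled by Fin n (n ≥ 1); arithmetic is done on representatives mod n.
-- A 2-colouring of ℤ_n is a function c : Fin n → Bool.
Coloring : ℕ → Set
Coloring n = Fin n → Bool

apTerm : (n : ℕ) .{{_ : NonZero n}} → Fin n → Fin n → ℕ → Fin n
apTerm n a d i = fromℕ< (m%n<n (toℕ a + i * toℕ d) n)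

allSame : ∀ {n} → Coloring n → List (Fin n) → Bool
allSame c [] = true
allSame c (x ∷ xs) = foldr (λ y b → ⌊ c y ≟ c x ⌋ ∧ b) true xs

ap : (n : ℕ) .{{_ : NonZero n}} → ℕ → Fin n → Fin n → List (Fin n)
ap n k a d = map (λ i → apTerm n a d (toℕ i)) (allFin k)

isMonoAP : (n : ℕ) .{{_ : NonZero n}} → ℕ → Coloring n → Fin n → Fin n → Bool
isMonoAP n k c a d = allSame c (ap n k a d)

boolToℕ : Bool → ℕ
boolToℕ true = 1
boolToℕ false = 0

monoCount : (n : ℕ) .{{_ : NonZero n}} → ℕ → Coloring n → ℕ
monoCount n k c =
  sum (concatMap (λ a → map (λ d → boolToℕ (isMonoAP n k c a d)) (allFin n)) (allFin n))

allColorings : (n : ℕ) → List (Coloring n)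
allColorings zero = (λ ()) ∷ []
allColorings (suc n) =
  concatMap (λ c → (λ { Fin.zero → false ; (Fin.suc i) → c i })
                 ∷ (λ { Fin.zero → true ; (Fin.suc i) → c i }) ∷ [])
            (allColorings n)

minList : ℕ → List ℕ → ℕ
minList x xs = foldr _⊓_ x xs

minMonoCount : (n : ℕ) .{{_ : NonZero n}} → ℕ → ℕ
minMonoCount n k = minList (monoCount n k (λ _ → false)) (map (monoCount n k) (allColorings n))

m : (k n : ℕ) .{{_ : NonZero n}} → ℚᵘ
m k n = (+ minMonoCount n k) / (n * n)
  where instance _ = m*n≢0 n n

module Submission where

-- Idea.  Write ℤ_{pt} as t blocks of p consecutive residues, z = p·u + r.  From a
-- colouring c of ℤ_t and a colouring P of the non-zero residues mod p, colour z by
-- c(u) when r = 0 and by P(r) otherwise.  Split the pairs (a, d) as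
-- a = p·u + r, d = p·v + s (0 ≤ r, s < p):
--   * s ≠ 0: the residues of the AP mod p form an AP of ℤ_p with non-zero difference;
--     if P "breaks" all of them, whatever the colours at residue 0, none is monochromatic;
--   * s = 0, r = 0: the AP is p times the AP (u, u + v, …) of ℤ_t, with the same colours;
--   * s = 0, r ≠ 0: at most one pair each, (p − 1)·t² pairs in total.
-- Hence m_k(ℤ_{pt}, lift c) ≤ m_k(ℤ_t, c) + (p − 1)t².  For p = 11, k = 4 the quadratic
-- residues mod 11 break every 4-AP with non-zero difference (checked by computation),
-- and dividing by (11t)² gives the theorem.

module Proof where

  open import Defs
  open import Function using (_∘_)
  open import Data.Nat
  open import Data.Nat.Properties
  open import Data.Nat.DivMod
  open import Data.Nat.Divisibility using (_∣_; divides)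
  open import Data.Nat.ListAction using (sum)
  open import Data.Nat.ListAction.Properties using (sum-++)
  open import Data.Nat.Tactic.RingSolver using (solve-∀)
  open import Data.Bool using (Bool; true; false; _∧_; not; T)
  open import Data.Bool.Properties as Bool using (T-not-≡)
  open import Data.Bool.ListAction using (all)
  open import Data.Fin using (Fin; toℕ; fromℕ<)
  open import Data.Fin.Properties using (toℕ-fromℕ<; toℕ-injective; toℕ<n)
  open import Data.List using (List; []; _∷_; map; allFin; foldr; concatMap; tabulate; upTo)
  open import Data.List.Properties using (map-cong; map-∘; map-tabulate; foldr-map; foldr-preservesᵒ)
  open import Data.List.Membership.Propositional using (_∈_)
  open import Data.List.Membership.Propositional.Properties
    using (∈-map⁺; ∈-map⁻; ∈-concat⁺′; ∈-upTo⁺; foldr-selective)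
  open import Data.List.Relation.Unary.Any as Any using (here; there)
  import Data.List.Relation.Unary.All as All
  open import Data.List.Relation.Unary.All.Properties using (all⁺)
  open import Data.Product using (∃; _×_; _,_)
  open import Data.Sum using (inj₁; inj₂; [_,_])
  open import Function.Bundles using (Equivalence)
  open import Relation.Binary.PropositionalEquality hiding ([_])
  open import Relation.Nullary.Decidable using (⌊_⌋)
  import Data.Integer as ℤ
  import Data.Integer.Properties as ℤ
  import Data.Rational.Unnormalised as ℚ

  sumBelow : ℕ → (ℕ → ℕ) → ℕ
  sumBelow zero    f = 0
  sumBelow (suc n) f = f 0 + sumBelow n (f ∘ suc)

  sumBelow-cong : ∀ n {f g : ℕ → ℕ} → (∀ i → f i ≡ g i) → sumBelow n f ≡ sumBelow n g
  sumBelow-cong zero    f≗g = refl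
  sumBelow-cong (suc n) f≗g = cong₂ _+_ (f≗g 0) (sumBelow-cong n (f≗g ∘ suc))

  sumBelow-mono : ∀ n {f g : ℕ → ℕ} → (∀ i → i < n → f i ≤ g i) → sumBelow n f ≤ sumBelow n g
  sumBelow-mono zero    f≤g = z≤n
  sumBelow-mono (suc n) f≤g = +-mono-≤ (f≤g 0 z<s) (sumBelow-mono n (λ i i<n → f≤g (suc i) (s<s i<n)))

  sumBelow-const : ∀ n x → sumBelow n (λ _ → x) ≡ n * x
  sumBelow-const zero    x = refl
  sumBelow-const (suc n) x = cong (x +_) (sumBelow-const n x)

  sumBelow-distrib : ∀ n f g → sumBelow n (λ i → f i + g i) ≡ sumBelow n f + sumBelow n g
  sumBelow-distrib zero    f g = refl
  sumBelow-distrib (suc n) f g = begin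
    f 0 + g 0 + sumBelow n (λ i → f (suc i) + g (suc i))
      ≡⟨ cong (f 0 + g 0 +_) (sumBelow-distrib n (f ∘ suc) (g ∘ suc)) ⟩
    f 0 + g 0 + (sumBelow n (f ∘ suc) + sumBelow n (g ∘ suc))
      ≡⟨ +-comm-middle (f 0) (g 0) _ _ ⟩
    f 0 + sumBelow n (f ∘ suc) + (g 0 + sumBelow n (g ∘ suc))
      ∎
    where
    open ≡-Reasoning
    +-comm-middle : ∀ a b c d → a + b + (c + d) ≡ a + c + (b + d)
    +-comm-middle = solve-∀

  sumBelow-split : ∀ m n f → sumBelow (m + n) f ≡ sumBelow m f + sumBelow n (λ i → f (m + i))
  sumBelow-split zero    n f = refl
  sumBelow-split (suc m) n f =
    trans (cong (f 0 +_) (sumBelow-split m n (f ∘ suc))) (sym (+-assoc (f 0) _ _))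

  sumBelow-blocks : ∀ p t f → sumBelow (p * t) f ≡ sumBelow t (λ u → sumBelow p (λ r → f (p * u + r)))
  sumBelow-blocks p zero    f = cong (λ n → sumBelow n f) (*-zeroʳ p)
  sumBelow-blocks p (suc t) f = begin
    sumBelow (p * suc t) f
      ≡⟨ cong (λ n → sumBelow n f) (*-suc p t) ⟩
    sumBelow (p + p * t) f
      ≡⟨ sumBelow-split p (p * t) f ⟩
    sumBelow p f + sumBelow (p * t) (λ i → f (p + i))
      ≡⟨ cong₂ _+_ (sumBelow-cong p (λ r → cong f (sym (+-identityˡ r))))
                   (sumBelow-blocks p t (λ i → f (p + i))) ⟩
    sumBelow p (λ r → f (0 + r)) + sumBelow t (λ u → sumBelow p (λ r → f (p + (p * u + r))))
      ≡⟨ cong₂ (λ a b → sumBelow p (λ r → f (a + r)) + b) (sym (*-zeroʳ p))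
               (sumBelow-cong t (λ u → sumBelow-cong p (λ r → cong f (next-block u r)))) ⟩
    sumBelow (suc t) (λ u → sumBelow p (λ r → f (p * u + r)))
      ∎
    where
    open ≡-Reasoning
    next-block : ∀ u r → p + (p * u + r) ≡ p * suc u + r
    next-block u r = trans (sym (+-assoc p (p * u) r)) (cong (_+ r) (sym (*-suc p u)))

  sum-allFin : ∀ n (f : ℕ → ℕ) → sum (map (f ∘ toℕ) (allFin n)) ≡ sumBelow n f
  sum-allFin n f = trans (cong sum (map-tabulate {n = n} (λ i → i) (f ∘ toℕ))) (sum-tabulate n f)
    where
    sum-tabulate : ∀ n (f : ℕ → ℕ) → sum (tabulate {n = n} (f ∘ toℕ)) ≡ sumBelow n f
    sum-tabulate zero    f = refl
    sum-tabulate (suc n) f = cong (f 0 +_) (sum-tabulate n (f ∘ suc))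

  sum-concatMap : ∀ {A : Set} (f : A → List ℕ) xs → sum (concatMap f xs) ≡ sum (map (sum ∘ f) xs)
  sum-concatMap f []       = refl
  sum-concatMap f (x ∷ xs) = trans (sum-++ (f x) (concatMap f xs)) (cong (sum (f x) +_) (sum-concatMap f xs))

  allEqual : List Bool → Bool
  allEqual []       = true
  allEqual (x ∷ xs) = foldr (λ y b → ⌊ y Bool.≟ x ⌋ ∧ b) true xs

  allSame-colours : ∀ {n} (c : Coloring n) xs → allSame c xs ≡ allEqual (map c xs)
  allSame-colours c []       = refl
  allSame-colours c (x ∷ xs) = sym (foldr-map (λ y b → ⌊ y Bool.≟ c x ⌋ ∧ b) c true xs)

  apTermℕ : (n : ℕ) .{{_ : NonZero n}} → ℕ → ℕ → ℕ → Fin n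
  apTermℕ n a d i = fromℕ< (m%n<n (a + i * d) n)

  apColours : (n : ℕ) .{{_ : NonZero n}} → ℕ → Coloring n → ℕ → ℕ → List Bool
  apColours n k c a d = map (λ i → c (apTermℕ n a d (toℕ i))) (allFin k)

  monoIndicator : (n : ℕ) .{{_ : NonZero n}} → ℕ → Coloring n → ℕ → ℕ → ℕ
  monoIndicator n k c a d = boolToℕ (allEqual (apColours n k c a d))

  monoCount-sum : (n : ℕ) .{{_ : NonZero n}} (k : ℕ) (c : Coloring n) →
    monoCount n k c ≡ sumBelow n (λ a → sumBelow n (λ d → monoIndicator n k c a d))
  monoCount-sum n k c = begin
    monoCount n k c
      ≡⟨ sum-concatMap _ (allFin n) ⟩
    sum (map (λ a → sum (map (λ d → boolToℕ (isMonoAP n k c a d)) (allFin n))) (allFin n))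
      ≡⟨ cong sum (map-cong (λ a → sum-allFin n (indicator (toℕ a))) (allFin n)) ⟩
    sum (map (λ a → sumBelow n (indicator (toℕ a))) (allFin n))
      ≡⟨ sum-allFin n (λ a → sumBelow n (indicator a)) ⟩
    sumBelow n (λ a → sumBelow n (indicator a))
      ≡⟨ sumBelow-cong n (λ a → sumBelow-cong n (λ d → cong boolToℕ (allSame-apColours a d))) ⟩
    sumBelow n (λ a → sumBelow n (λ d → monoIndicator n k c a d))
      ∎
    where
    open ≡-Reasoning
    indicator : ℕ → ℕ → ℕ
    indicator a d = boolToℕ (allSame c (map (λ i → apTermℕ n a d (toℕ i)) (allFin k)))
    allSame-apColours : ∀ a d → allSame c (map (λ i → apTermℕ n a d (toℕ i)) (allFin k)) ≡ allEqual (apColours n k c a d)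
    allSame-apColours a d = trans (allSame-colours c (map (λ i → apTermℕ n a d (toℕ i)) (allFin k)))
                                    (cong allEqual (sym (map-∘ {g = c} (allFin k))))

  monoIndicator-cong : ∀ {n m} .{{_ : NonZero n}} .{{_ : NonZero m}} k (c : Coloring n) (c' : Coloring m) a d a' d' →
    (∀ i → c (apTermℕ n a d i) ≡ c' (apTermℕ m a' d' i)) → monoIndicator n k c a d ≡ monoIndicator m k c' a' d'
  monoIndicator-cong k c c' a d a' d' same = cong (boolToℕ ∘ allEqual) (map-cong (same ∘ toℕ) (allFin k))

  monoCount-ext : (n : ℕ) .{{_ : NonZero n}} (k : ℕ) (c c' : Coloring n) → (∀ x → c x ≡ c' x) → monoCount n k c ≡ monoCount n k c'
  monoCount-ext n k c c' c≗c' = begin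
    monoCount n k c
      ≡⟨ monoCount-sum n k c ⟩
    sumBelow n (λ a → sumBelow n (λ d → monoIndicator n k c a d))
      ≡⟨ sumBelow-cong n (λ a → sumBelow-cong n (λ d → monoIndicator-cong k c c' a d a d (λ i → c≗c' _))) ⟩
    sumBelow n (λ a → sumBelow n (λ d → monoIndicator n k c' a d))
      ≡⟨ monoCount-sum n k c' ⟨
    monoCount n k c'
      ∎
    where open ≡-Reasoning

  allColorings-complete : ∀ n (c : Coloring n) → ∃ λ c₀ → c₀ ∈ allColorings n × (∀ x → c₀ x ≡ c x)
  allColorings-complete zero    c = _ , here refl , λ ()
  allColorings-complete (suc n) c with allColorings-complete n (c ∘ Fin.suc) | c Fin.zero in c0
  ... | c₁ , c₁∈ , c₁≗ | false =
    _ , ∈-concat⁺′ (here refl) (∈-map⁺ _ c₁∈) , λ { Fin.zero → sym c0 ; (Fin.suc x) → c₁≗ x }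
  ... | c₁ , c₁∈ , c₁≗ | true =
    _ , ∈-concat⁺′ (there (here refl)) (∈-map⁺ _ c₁∈) , λ { Fin.zero → sym c0 ; (Fin.suc x) → c₁≗ x }

  minMonoCount-≤ : (n : ℕ) .{{_ : NonZero n}} (k : ℕ) (c : Coloring n) → minMonoCount n k ≤ monoCount n k c
  minMonoCount-≤ n k c with allColorings-complete n c
  ... | c₀ , c₀∈ , c₀≗c =
    foldr-preservesᵒ (λ x y → [ m≤n⇒m⊓o≤n y , m≤n⇒o⊓m≤n x ]) _ _
      (inj₂ (Any.map (λ eq → ≤-reflexive (trans (sym eq) (monoCount-ext n k c₀ c c₀≗c)))
                (∈-map⁺ (monoCount n k) c₀∈)))

  minMonoCount-attained : (n : ℕ) .{{_ : NonZero n}} (k : ℕ) → ∃ λ c → minMonoCount n k ≡ monoCount n k c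
  minMonoCount-attained n k with foldr-selective ⊓-sel (monoCount n k (λ _ → false)) (map (monoCount n k) (allColorings n))
  ... | inj₁ eq = _ , eq
  ... | inj₂ ∈ms with ∈-map⁻ (monoCount n k) ∈ms
  ...   | c , _ , eq = c , eq

  -- Colour of a point of ℤ_{pt} with residue r mod p: points ≡ 0 mod p inherit the
  -- colour b of their block, all others are coloured by the pattern P.
  blend : (ℕ → Bool) → ℕ → Bool → Bool
  blend P zero    b = b
  blend P (suc r) b = P (suc r)

  -- P breaks every k-AP of ℤ_p with non-zero difference s + 1, whatever colours β the
  -- terms ≡ 0 mod p receive.
  Breaks : (p : ℕ) .{{_ : NonZero p}} → ℕ → (ℕ → Bool) → Set
  Breaks p k P = ∀ r s → r < p → suc s < p → (β : Fin k → Bool) →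
    allEqual (map (λ i → blend P ((r + toℕ i * suc s) % p) (β i)) (allFin k)) ≡ false

  apTerm-residue : ∀ n p .{{_ : NonZero n}} .{{_ : NonZero p}} → p ∣ n → ∀ a d i →
    toℕ (apTermℕ n a d i) % p ≡ (a + i * d) % p
  apTerm-residue n p p∣n a d i =
    trans (cong (_% p) (toℕ-fromℕ< (m%n<n (a + i * d) n))) (m∣n⇒o%n%m≡o%m p n (a + i * d) p∣n)

  boolToℕ-≤1 : ∀ b → boolToℕ b ≤ 1
  boolToℕ-≤1 true  = s≤s z≤n
  boolToℕ-≤1 false = z≤n

  module Blowup (p' : ℕ) (P : ℕ → Bool) (k t : ℕ) .{{_ : NonZero t}} (c : Coloring t) where

    p : ℕ
    p = suc p'

    instance
      pt≢0 : NonZero (p * t)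
      pt≢0 = m*n≢0 p t
      tp≢0 : NonZero (t * p)
      tp≢0 = m*n≢0 t p

    block : Fin (p * t) → Fin t
    block z = fromℕ< (m%n<n (toℕ z / p) t)

    lift : Coloring (p * t)
    lift z = blend P (toℕ z % p) (c (block z))

    residue : ∀ u r v s i → toℕ (apTermℕ (p * t) (p * u + r) (p * v + s) i) % p ≡ (r + i * s) % p
    residue u r v s i = begin
      toℕ (apTermℕ (p * t) (p * u + r) (p * v + s) i) % p
        ≡⟨ apTerm-residue (p * t) p (divides t (*-comm p t)) (p * u + r) (p * v + s) i ⟩
      (p * u + r + i * (p * v + s)) % p
        ≡⟨ cong (_% p) (regroup p u r v s i) ⟩
      (r + i * s + (u + i * v) * p) % p
        ≡⟨ [m+kn]%n≡m%n (r + i * s) (u + i * v) p ⟩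
      (r + i * s) % p
        ∎
      where
      open ≡-Reasoning
      regroup : ∀ p u r v s i → p * u + r + i * (p * v + s) ≡ r + i * s + (u + i * v) * p
      regroup = solve-∀

    scaled-term : ∀ u v i → toℕ (apTermℕ (p * t) (p * u + 0) (p * v + 0) i) ≡ toℕ (apTermℕ t u v i) * p
    scaled-term u v i = begin
      toℕ (apTermℕ (p * t) (p * u + 0) (p * v + 0) i)
        ≡⟨ toℕ-fromℕ< (m%n<n (p * u + 0 + i * (p * v + 0)) (p * t)) ⟩
      (p * u + 0 + i * (p * v + 0)) % (p * t)
        ≡⟨ %-congˡ {o = p * t} (factor p u v i) ⟩
      (u + i * v) * p % (p * t)
        ≡⟨ %-congʳ (*-comm p t) ⟩
      (u + i * v) * p % (t * p)
        ≡⟨ m%n*o≡m*o%[n*o] (u + i * v) t p ⟨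
      (u + i * v) % t * p
        ≡⟨ cong (_* p) (toℕ-fromℕ< (m%n<n (u + i * v) t)) ⟨
      toℕ (apTermℕ t u v i) * p
        ∎
      where
      open ≡-Reasoning
      factor : ∀ p u v i → p * u + 0 + i * (p * v + 0) ≡ (u + i * v) * p
      factor = solve-∀

    lift-multiple : ∀ z (x : Fin t) → toℕ z ≡ toℕ x * p → lift z ≡ c x
    lift-multiple z x z≡xp = cong₂ (blend P) (trans (cong (_% p) z≡xp) (m*n%n≡0 (toℕ x) p)) (cong c block≡x)
      where
      block≡x : block z ≡ x
      block≡x = toℕ-injective (begin
        toℕ (block z)       ≡⟨ toℕ-fromℕ< (m%n<n (toℕ z / p) t) ⟩
        toℕ z / p % t       ≡⟨ cong (λ y → y / p % t) z≡xp ⟩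
        toℕ x * p / p % t   ≡⟨ cong (_% t) (m*n/n≡m (toℕ x) p) ⟩
        toℕ x % t           ≡⟨ m<n⇒m%n≡m (toℕ<n x) ⟩
        toℕ x               ∎)
        where open ≡-Reasoning

    indicator-scaled : ∀ u v → monoIndicator (p * t) k lift (p * u + 0) (p * v + 0) ≡ monoIndicator t k c u v
    indicator-scaled u v =
      monoIndicator-cong k lift c (p * u + 0) (p * v + 0) u v (λ i → lift-multiple _ _ (scaled-term u v i))

    indicator-broken : Breaks p k P → ∀ u r v s → r < p → suc s < p →
      monoIndicator (p * t) k lift (p * u + r) (p * v + suc s) ≡ 0
    indicator-broken breaks u r v s r<p s<p = cong boolToℕ (trans
      (cong allEqual (map-cong (λ i → cong (λ e → blend P e (β i)) (residue u r v (suc s) (toℕ i))) (allFin k)))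
      (breaks r s r<p s<p β))
      where
      β : Fin k → Bool
      β i = c (block (apTermℕ (p * t) (p * u + r) (p * v + suc s) (toℕ i)))

    pairBound : ℕ → ℕ → ℕ → ℕ → ℕ
    pairBound u v r       (suc s) = 0
    pairBound u v zero    zero    = monoIndicator t k c u v
    pairBound u v (suc r) zero    = 1

    pairBound-≥ : Breaks p k P → ∀ u v r s → r < p → s < p →
      monoIndicator (p * t) k lift (p * u + r) (p * v + s) ≤ pairBound u v r s
    pairBound-≥ breaks u v r       (suc s) r<p s<p = ≤-reflexive (indicator-broken breaks u r v s r<p s<p)
    pairBound-≥ breaks u v zero    zero    _   _   = ≤-reflexive (indicator-scaled u v)
    pairBound-≥ breaks u v (suc r) zero    _   _   = boolToℕ-≤1 _

    pairBound-sum : ∀ u → sumBelow p (λ r → sumBelow t (λ v → sumBelow p (λ s → pairBound u v r s)))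
                        ≡ sumBelow t (λ v → monoIndicator t k c u v) + p' * t
    pairBound-sum u = begin
      sumBelow p (λ r → sumBelow t (λ v → sumBelow p (λ s → pairBound u v r s)))
        ≡⟨ sumBelow-cong p (λ r → sumBelow-cong t (λ v → only-s≡0 v r)) ⟩
      sumBelow t (λ v → monoIndicator t k c u v) + sumBelow p' (λ _ → sumBelow t (λ _ → 1))
        ≡⟨ cong (sumBelow t (λ v → monoIndicator t k c u v) +_)
                (trans (sumBelow-const p' (sumBelow t (λ _ → 1)))
                       (cong (p' *_) (trans (sumBelow-const t 1) (*-identityʳ t)))) ⟩
      sumBelow t (λ v → monoIndicator t k c u v) + p' * t
        ∎
      where
      open ≡-Reasoning
      only-s≡0 : ∀ v r → sumBelow p (λ s → pairBound u v r s) ≡ pairBound u v r 0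
      only-s≡0 v r = trans (cong (pairBound u v r 0 +_) (trans (sumBelow-const p' 0) (*-zeroʳ p')))
                           (+-identityʳ _)

    blowup : Breaks p k P → monoCount (p * t) k lift ≤ monoCount t k c + p' * (t * t)
    blowup breaks = begin
      monoCount (p * t) k lift
        ≡⟨ monoCount-sum (p * t) k lift ⟩
      sumBelow (p * t) (λ a → sumBelow (p * t) (λ d → monoIndicator (p * t) k lift a d))
        ≡⟨ sumBelow-blocks p t (λ a → sumBelow (p * t) (I a)) ⟩
      sumBelow t (λ u → sumBelow p (λ r → sumBelow (p * t) (λ d → I (p * u + r) d)))
        ≡⟨ sumBelow-cong t (λ u → sumBelow-cong p (λ r → sumBelow-blocks p t (I (p * u + r)))) ⟩
      sumBelow t (λ u → sumBelow p (λ r → sumBelow t (λ v → sumBelow p (λ s → I (p * u + r) (p * v + s)))))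
        ≤⟨ sumBelow-mono t (λ u _ → sumBelow-mono p (λ r r<p → sumBelow-mono t (λ v _ →
             sumBelow-mono p (λ s s<p → pairBound-≥ breaks u v r s r<p s<p)))) ⟩
      sumBelow t (λ u → sumBelow p (λ r → sumBelow t (λ v → sumBelow p (λ s → pairBound u v r s))))
        ≡⟨ sumBelow-cong t pairBound-sum ⟩
      sumBelow t (λ u → sumBelow t (λ v → monoIndicator t k c u v) + p' * t)
        ≡⟨ sumBelow-distrib t _ _ ⟩
      sumBelow t (λ u → sumBelow t (λ v → monoIndicator t k c u v)) + sumBelow t (λ _ → p' * t)
        ≡⟨ cong₂ _+_ (sym (monoCount-sum t k c)) (trans (sumBelow-const t (p' * t)) (swap t p')) ⟩
      monoCount t k c + p' * (t * t)
        ∎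
      where
      open ≤-Reasoning
      I : ℕ → ℕ → ℕ
      I = monoIndicator (p * t) k lift
      swap : ∀ t p' → t * (p' * t) ≡ p' * (t * t)
      swap = solve-∀

  all-at : ∀ {A : Set} (f : A → Bool) {xs x} → T (all f xs) → x ∈ xs → T (f x)
  all-at f ok x∈xs = All.lookup (all⁺ f _ ok) x∈xs

  breaksCheck : (p : ℕ) .{{_ : NonZero p}} → ℕ → (ℕ → Bool) → Bool
  breaksCheck p k P = all (λ r → all (λ s → all (λ β →
      not (allEqual (map (λ i → blend P ((r + toℕ i * suc s) % p) (β i)) (allFin k))))
    (allColorings k)) (upTo (pred p))) (upTo p)

  -- A successful check establishes Breaks (β is replaced by its pointwise-equal enumerated copy).
  breaks-from-check : (p : ℕ) .{{_ : NonZero p}} (k : ℕ) (P : ℕ → Bool) → T (breaksCheck p k P) → Breaks p k P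
  breaks-from-check p k P ok r s r<p s<p β with allColorings-complete k β
  ... | β₀ , β₀∈ , β₀≗β = trans
    (cong allEqual (map-cong (λ i → cong (blend P ((r + toℕ i * suc s) % p)) (sym (β₀≗β i))) (allFin k)))
    (Equivalence.to T-not-≡ (all-at _ (all-at _ (all-at _ ok (∈-upTo⁺ r<p)) (∈-upTo⁺ (<⇒≤pred s<p))) β₀∈))

  squareMod11 : ℕ → Bool
  squareMod11 1 = true
  squareMod11 3 = true
  squareMod11 4 = true
  squareMod11 5 = true
  squareMod11 9 = true
  squareMod11 _ = false

  squares-break : Breaks 11 4 squareMod11
  squares-break = breaks-from-check 11 4 squareMod11 _

  -- Numerators: min_c m₄(ℤ_{11t}, c) ≤ min_c m₄(ℤ_t, c) + 10·t², by lifting an optimal colouring.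
  minMonoCount-11t : (t' : ℕ) → let t = suc t' in minMonoCount (11 * t) 4 ≤ minMonoCount t 4 + 10 * (t * t)
  minMonoCount-11t t' with minMonoCount-attained (suc t') 4
  ... | c , min≡c = begin
    minMonoCount (11 * t) 4          ≤⟨ minMonoCount-≤ (11 * t) 4 lift ⟩
    monoCount (11 * t) 4 lift        ≤⟨ blowup squares-break ⟩
    monoCount t 4 c + 10 * (t * t)   ≡⟨ cong (_+ 10 * (t * t)) min≡c ⟨
    minMonoCount t 4 + 10 * (t * t)  ∎
    where
    open ≤-Reasoning
    t : ℕ
    t = suc t'
    open Blowup 10 squareMod11 4 t c

  ratio-bound : (t' a b : ℕ) → let t = suc t' in a ≤ b + 10 * (t * t) →
    ℤ.+ a ℚ./ (11 * t * (11 * t)) ℚ.≤ (ℤ.+ 10 ℚ./ 1 ℚ.+ ℤ.+ b ℚ./ (t * t)) ℚ.* (ℤ.+ 1 ℚ./ 121)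
  ratio-bound t' a b a≤b+10t² = ℚ.*≤* (begin
    ℤ.+ a ℤ.* ℤ.+ (1 * (t * t) * 121)
      ≡⟨ ℤ.pos-* a (1 * (t * t) * 121) ⟨
    ℤ.+ (a * (1 * (t * t) * 121))
      ≤⟨ ℤ.+≤+ (≤-trans (*-monoˡ-≤ (1 * (t * t) * 121) a≤b+10t²) (≤-reflexive (cross b t))) ⟩
    ℤ.+ ((10 * (t * t) + b * 1) * 1 * D)
      ≡⟨ ℤ.pos-* ((10 * (t * t) + b * 1) * 1) D ⟩
    ℤ.+ ((10 * (t * t) + b * 1) * 1) ℤ.* ℤ.+ D
      ≡⟨ cong (ℤ._* ℤ.+ D) (ℤ.pos-* (10 * (t * t) + b * 1) 1) ⟩
    ℤ.+ (10 * (t * t) + b * 1) ℤ.* ℤ.+ 1 ℤ.* ℤ.+ D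
      ≡⟨ cong (λ x → x ℤ.* ℤ.+ 1 ℤ.* ℤ.+ D) (ℤ.pos-+ (10 * (t * t)) (b * 1)) ⟩
    (ℤ.+ (10 * (t * t)) ℤ.+ ℤ.+ (b * 1)) ℤ.* ℤ.+ 1 ℤ.* ℤ.+ D
      ≡⟨ cong (λ x → x ℤ.* ℤ.+ 1 ℤ.* ℤ.+ D) (cong₂ ℤ._+_ (ℤ.pos-* 10 (t * t)) (ℤ.pos-* b 1)) ⟩
    (ℤ.+ 10 ℤ.* ℤ.+ (t * t) ℤ.+ ℤ.+ b ℤ.* ℤ.+ 1) ℤ.* ℤ.+ 1 ℤ.* ℤ.+ D
      ∎)
    where
    open ℤ.≤-Reasoning
    t D : ℕ
    t = suc t'
    D = 11 * t * (11 * t)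
    cross : ∀ b t → (b + 10 * (t * t)) * (1 * (t * t) * 121) ≡ (10 * (t * t) + b * 1) * 1 * (11 * t * (11 * t))
    cross = solve-∀


open import Defs
open import Data.Nat using (ℕ; _≥_; NonZero; >-nonZero; s≤s; z≤n) renaming (_*_ to _*ℕ_)
open import Data.Nat.Properties using (≤-trans; m*n≢0)
open import Data.Integer using (+_)
open import Data.Rational.Unnormalised using (_≤_; _+_; _*_; _/_)

lemma6 : (t : ℕ) → (t≥2 : t ≥ 2) →
    let instance
          nzt : NonZero t
          nzt = >-nonZero (≤-trans (s≤s z≤n) t≥2)
          nz11t : NonZero (11 *ℕ t)
          nz11t = m*n≢0 11 t
    in m 4 (11 *ℕ t) ≤ (+ 10 / 1 + m 4 t) * (+ 1 / 121)
lemma6 (ℕ.suc t') _ = Proof.ratio-bound t' _ _ (Proof.minMonoCount-11t t')
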